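{- Let $m \ge 2$ and $n \ge 3$ be odd integers, and let the integers $c_{ij}$ be defined by $\zeta_m^i = \sum_{j=0}^{\phi(m)-1} c_{ij}\zeta_m^j$ for $0 \le i \le m-1$. Suppose $a$ is a positive integer such that $a^i \equiv \sum_{j=0}^{\phi(m)-1} c_{ij} a^j \pmod n$ for $\phi(m) \le i \le m-1$, $a^m \equiv 1 \pmod n$, and $a^i \not\equiv \pm 1 \pmod n$ for $1 \le i \le m-1$. Then $\mathrm{Cay}(\mathbb{Z}_n, \langle [-a]\rangle) \cong G_m(A_{m,n,a})$, where $$A_{m,n,a} := \left\{\sum_{i=0}^{\phi(m)-1} a_i\zeta_m^i \in \mathbb{Z}[\zeta_m] : a_i \in \mathbb{Z},\ \sum_{i=0}^{\phi(m)-1} a_i a^i \equiv 0 \pmod n\right\}.$$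
   Context: $\zeta_m = e^{2\pi i/m}$, $\mathbb{Z}[\zeta_m]$ is the ring of integers of $\mathbb{Q}(\zeta_m)$, $\phi$ is Euler's totient function, and $1, \zeta_m, \dots, \zeta_m^{\phi(m)-1}$ is a $\mathbb{Z}$-basis of $\mathbb{Z}[\zeta_m]$ (so the $c_{ij}$ are uniquely determined integers). $\langle [-a]\rangle$ denotes the cyclic subgroup of the unit group $\mathbb{Z}_n^*$ generated by the residue class of $-a$. $\mathrm{Cay}(\mathbb{Z}_n, S)$ is the Cayley graph on the additive group $\mathbb{Z}_n$ with $x,y$ adjacent iff $x-y\in S$. For a nonzero ideal $A$ of $\mathbb{Z}[\zeta_m]$, $G_m(A)$ is the Cayley graph on the additive group of $\mathbb{Z}[\zeta_m]/A$ with connection set $\{\pm(\zeta_m^i + A) : 0 \le i \le m-1\}$. -}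

module Defs where

open import Data.Nat as ℕ using (ℕ; zero; suc; _∸_; _≡ᵇ_)
open import Data.Nat.GCD using (gcd)
open import Data.Nat.Divisibility as ℕD using (_∣?_)
open import Data.Integer as ℤ using (ℤ; +_; _+_; _-_; _*_; -_; _^_)
open import Data.Integer.Divisibility using (_∣_)
open import Data.Fin using (Fin; toℕ)
open import Data.List using (List; []; _∷_; _++_; map; length; reverse; replicate; filter; zip; upTo; foldr; lookup)
open import Data.Bool using (Bool; true; false; if_then_else_)
open import Data.Product using (Σ; _×_; _,_; proj₁; proj₂; ∃)
open import Data.Sum using (_⊎_)
open import Relation.Nullary using (does)
open import Relation.Binary.PropositionalEquality using (_≡_)

φ : ℕ → ℕ
φ m = length (filter (λ k → gcd k m ℕ.≟ 1) (map suc (upTo m)))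

-- low-to-high addition with padding
addL : List ℤ → List ℤ → List ℤ
addL [] ys = ys
addL (x ∷ xs) [] = x ∷ xs
addL (x ∷ xs) (y ∷ ys) = (x + y) ∷ addL xs ys

mulL : List ℤ → List ℤ → List ℤ
mulL [] q = []
mulL (x ∷ p) q = addL (map (x *_) q) (+ 0 ∷ mulL p q)

prodL : List (List ℤ) → List ℤ
prodL = foldr mulL (+ 1 ∷ [])

subPrefix : List ℤ → List ℤ → List ℤ
subPrefix [] ys = ys
subPrefix (x ∷ xs) [] = (- x) ∷ subPrefix xs []
subPrefix (x ∷ xs) (y ∷ ys) = (y - x) ∷ subPrefix xs ys

-- quotient of p by a monic polynomial 1 ∷ qs (both high-to-low),
-- by synthetic long division
divMonicGo : ℕ → List ℤ → List ℤ → List ℤ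
divMonicGo zero qs r = []
divMonicGo (suc f) qs [] = []
divMonicGo (suc f) qs (t ∷ r) = t ∷ divMonicGo f qs (subPrefix (map (t *_) qs) r)

divMonic : List ℤ → List ℤ → List ℤ
divMonic p [] = []
divMonic p (_ ∷ qs) = divMonicGo (length p ∸ length qs) qs p

xm1 : ℕ → List ℤ
xm1 zero = []
xm1 (suc k) = (ℤ.-[1+ 0 ]) ∷ replicate k (+ 0) ++ (+ 1 ∷ [])

-- given prev = [Φ_1, …, Φ_{m-1}] (low-to-high), compute
-- Φ_m = (x^m - 1) / ∏_{d ∣ m, d < m} Φ_d
properDivisorPolys : ℕ → List (List ℤ) → List (List ℤ)
properDivisorPolys m prev =
  map proj₂ (filter (λ dp → proj₁ dp ∣? m) (zip (map suc (upTo (length prev))) prev))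

newCyclo : ℕ → List (List ℤ) → List ℤ
newCyclo m prev =
  reverse (divMonic (reverse (xm1 m)) (reverse (prodL (properDivisorPolys m prev))))

-- cyclos k = [Φ_1, …, Φ_k]
cyclos : ℕ → List (List ℤ)
cyclos zero = []
cyclos (suc k) = cyclos k ++ (newCyclo (suc k) (cyclos k) ∷ [])

cyclo : ℕ → List ℤ
cyclo zero = []
cyclo (suc k) = newCyclo (suc k) (cyclos k)

-- Reduction of x^i modulo Φ_m, i.e. the coordinates of ζ_m^i in the
-- power basis 1, ζ_m, …, ζ_m^{φ(m)-1}.

private
  tail0 : List ℤ → List ℤ
  tail0 [] = []
  tail0 (_ ∷ xs) = xs

  head0 : List ℤ → ℤ
  head0 [] = + 0
  head0 (x ∷ _) = x

-- x^i mod Φ_m as a high-to-low list of length deg Φ_m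
xPowMod : ℕ → ℕ → List ℤ
xPowMod m zero = reverse (+ 1 ∷ replicate (length (cyclo m) ∸ 2) (+ 0))
xPowMod m (suc i) =
  let r  = xPowMod m i
      qs = tail0 (reverse (cyclo m))
  in subPrefix (map (head0 r *_) qs) (tail0 r ++ (+ 0 ∷ []))

lookup0 : List ℤ → ℕ → ℤ
lookup0 [] _ = + 0
lookup0 (x ∷ xs) zero = x
lookup0 (x ∷ xs) (suc j) = lookup0 xs j

c : ℕ → ℕ → ℕ → ℤ
c m i j = lookup0 (reverse (xPowMod m i)) j

sumFin : (k : ℕ) → (Fin k → ℤ) → ℤ
sumFin zero f = + 0
sumFin (suc k) f = f Fin.zero + sumFin k (λ j → f (Fin.suc j))

infix 4 _≡_[mod_]
_≡_[mod_] : ℤ → ℤ → ℕ → Set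
x ≡ y [mod n ] = (+ n) ∣ (x - y)

-- Z[ζ_m] via coordinates in the Z-basis 1, ζ_m, …, ζ_m^{φ(m)-1}

Zζ : ℕ → Set
Zζ m = Fin (φ m) → ℤ

ζ^ : (m : ℕ) → ℕ → Zζ m
ζ^ m i j = c m i (toℕ j)

infixl 6 _⊖_ _⊕_
_⊖_ : ∀ {k} → (Fin k → ℤ) → (Fin k → ℤ) → Fin k → ℤ
(u ⊖ v) j = u j - v j

_⊕_ : ∀ {k} → (Fin k → ℤ) → (Fin k → ℤ) → Fin k → ℤ
(u ⊕ v) j = u j + v j

InA : (m n a : ℕ) → Zζ m → Set
InA m n a v = sumFin (φ m) (λ j → v j * (+ a) ^ toℕ j) ≡ + 0 [mod n ]

-- adjacency in G_m(A) between the cosets u + A and v + A: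
-- u - v ∈ {±ζ_m^i : 0 ≤ i ≤ m-1} + A
GAdj : (m n a : ℕ) → Zζ m → Zζ m → Set
GAdj m n a u v =
  Σ (Fin m) λ i → InA m n a ((u ⊖ v) ⊖ ζ^ m (toℕ i)) ⊎ InA m n a ((u ⊖ v) ⊕ ζ^ m (toℕ i))

CayAdj : (n a : ℕ) → Fin n → Fin n → Set
CayAdj n a x y = ∃ λ (k : ℕ) → (+ toℕ x) - (+ toℕ y) ≡ (- (+ a)) ^ k [mod n ]

-- a graph isomorphism Cay(Z_n, ⟨[-a]⟩) ≅ G_m(A_{m,n,a}): a map from Z_n to
-- representatives of Z[ζ_m]/A which is a bijection onto the cosets and
-- preserves and reflects adjacency.
record CayIsoG (m n a : ℕ) : Set where
  field
    f    : Fin n → Zζ m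
    inj  : ∀ x y → InA m n a (f x ⊖ f y) → x ≡ y
    surj : ∀ v → ∃ λ x → InA m n a (v ⊖ f x)
    adj⇒ : ∀ x y → CayAdj n a x y → GAdj m n a (f x) (f y)
    adj⇐ : ∀ x y → GAdj m n a (f x) (f y) → CayAdj n a x y

sumℕ : ℕ → (ℕ → ℤ) → ℤ
sumℕ zero f = + 0
sumℕ (suc k) f = sumℕ k f + f k

{-# OPTIONS --safe #-}
module Submission where

-- Evaluating coordinates at a, v ↦ Σ v_j a^j, is additive, and A_{m,n,a} is the kernel of its
-- reduction mod n; hence x ↦ x·1 is a bijection from Z_n onto Z[ζ_m]/A_{m,n,a}, inverted by
-- evaluation. Evaluation sends ζ_m^i to a^i mod n for every i < m: for φ(m) ≤ i by hypothesis,
-- and for i < φ(m) because ζ_m^i is then itself a basis vector. The latter needs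
-- deg Φ_m = φ(m), which follows from Gauss's identity Σ_{d ∣ m} φ(d) = m. Finally a^m ≡ 1 and
-- m odd give (-a)^m ≡ -1, so the powers of -a are exactly the residues ±a^i with i < m, and
-- the two adjacency relations match.

open import Defs
open import Relation.Binary.PropositionalEquality

module DivisorSum where

  open import Algebra.Properties.CommutativeSemigroup using (interchange)
  open import Data.Bool.Base using (if_then_else_)
  open import Data.List.Base using (List; []; _∷_; _++_; map; filter; applyUpTo; upTo; length)
  import Data.List.Properties as List
  open import Data.Nat.Base
    using (ℕ; zero; suc; _+_; _*_; _≤_; z≤n; s≤s; NonZero; >-nonZero; ≢-nonZero; ≢-nonZero⁻¹)
  open import Data.Nat.Properties
  open import Data.Nat.Divisibility using (_∣_; _∣?_; divides; ∣⇒≤; n∣m*n; ∣m+n∣m⇒∣n)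
  open import Data.Nat.GCD
    using (gcd; gcd-zeroˡ; gcd[m,n]∣m; gcd[m,n]∣n; gcd[m,n]≢0; c*gcd[m,n]≡gcd[cm,cn])
  open import Data.Nat.ListAction using (sum)
  open import Data.Nat.ListAction.Properties using (sum-++)
  open import Data.Sum.Base using (inj₁; inj₂)
  open import Function.Base using (_∘_)
  open import Function.Bundles using (_⇔_; mk⇔)
  open import Relation.Nullary.Decidable using (Dec; yes; no; does; dec-true; dec-false; does-⇔)
  open import Relation.Nullary.Negation using (¬_; contradiction)
  open import Relation.Unary using (Pred; Decidable)

  ∑₁ : ℕ → (ℕ → ℕ) → ℕ
  ∑₁ zero    f = 0
  ∑₁ (suc N) f = ∑₁ N f + f (suc N)

  𝟙 : ∀ {p} {P : Set p} → Dec P → ℕ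
  𝟙 P? = if does P? then 1 else 0

  module _ {p} {P : Set p} (P? : Dec P) where

    𝟙-yes : P → 𝟙 P? ≡ 1
    𝟙-yes x rewrite dec-true P? x = refl

    𝟙-no : ¬ P → 𝟙 P? ≡ 0
    𝟙-no ¬x rewrite dec-false P? ¬x = refl

    𝟙-⇔ : ∀ {q} {Q : Set q} (Q? : Dec Q) → P ⇔ Q → 𝟙 P? ≡ 𝟙 Q?
    𝟙-⇔ Q? P⇔Q = cong (λ b → if b then 1 else 0) (does-⇔ P⇔Q P? Q?)

  ∑₁-cong : ∀ N {f g} → (∀ {k} → 1 ≤ k → k ≤ N → f k ≡ g k) → ∑₁ N f ≡ ∑₁ N g
  ∑₁-cong zero    f≗g = refl
  ∑₁-cong (suc N) f≗g =
    cong₂ _+_ (∑₁-cong N (λ 1≤k k≤N → f≗g 1≤k (m≤n⇒m≤1+n k≤N))) (f≗g (s≤s z≤n) ≤-refl)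

  ∑₁-zero : ∀ N {f} → (∀ {k} → 1 ≤ k → k ≤ N → f k ≡ 0) → ∑₁ N f ≡ 0
  ∑₁-zero zero    f≗0 = refl
  ∑₁-zero (suc N) f≗0 =
    cong₂ _+_ (∑₁-zero N (λ 1≤k k≤N → f≗0 1≤k (m≤n⇒m≤1+n k≤N))) (f≗0 (s≤s z≤n) ≤-refl)

  ∑₁-const-1 : ∀ N → ∑₁ N (λ _ → 1) ≡ N
  ∑₁-const-1 zero    = refl
  ∑₁-const-1 (suc N) = trans (cong (_+ 1) (∑₁-const-1 N)) (+-comm N 1)

  ∑₁-distrib-+ : ∀ N f g → ∑₁ N (λ k → f k + g k) ≡ ∑₁ N f + ∑₁ N g
  ∑₁-distrib-+ zero    f g = refl
  ∑₁-distrib-+ (suc N) f g =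
    trans (cong (_+ (f (suc N) + g (suc N))) (∑₁-distrib-+ N f g))
          (interchange +-commutativeSemigroup (∑₁ N f) (∑₁ N g) (f (suc N)) (g (suc N)))

  ∑₁-comm : ∀ M N (f : ℕ → ℕ → ℕ) → ∑₁ M (λ i → ∑₁ N (f i)) ≡ ∑₁ N (λ j → ∑₁ M (λ i → f i j))
  ∑₁-comm zero    N f = sym (∑₁-zero N (λ _ _ → refl))
  ∑₁-comm (suc M) N f = trans (cong (_+ ∑₁ N (f (suc M))) (∑₁-comm M N f))
                              (sym (∑₁-distrib-+ N (λ j → ∑₁ M (λ i → f i j)) (f (suc M))))

  ∑₁-+ : ∀ a b f → ∑₁ (a + b) f ≡ ∑₁ a f + ∑₁ b (λ t → f (a + t))
  ∑₁-+ a zero    f = trans (cong (λ N → ∑₁ N f) (+-identityʳ a)) (sym (+-identityʳ _))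
  ∑₁-+ a (suc b) f = begin
    ∑₁ (a + suc b) f                                  ≡⟨ cong (λ N → ∑₁ N f) (+-suc a b) ⟩
    ∑₁ (a + b) f + f (suc (a + b))                    ≡⟨ cong₂ _+_ (∑₁-+ a b f) (cong f (sym (+-suc a b))) ⟩
    ∑₁ a f + ∑₁ b (λ t → f (a + t)) + f (a + suc b)   ≡⟨ +-assoc (∑₁ a f) _ _ ⟩
    ∑₁ a f + ∑₁ (suc b) (λ t → f (a + t))             ∎
    where open ≡-Reasoning

  ∑₁-𝟙-≡ : ∀ N {d₀} → 1 ≤ d₀ → d₀ ≤ N → ∑₁ N (λ d → 𝟙 (d ≟ d₀)) ≡ 1
  ∑₁-𝟙-≡ zero    1≤d₀ d₀≤0 = contradiction d₀≤0 (<⇒≱ 1≤d₀)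
  ∑₁-𝟙-≡ (suc N) {d₀} 1≤d₀ d₀≤1+N with m≤n⇒m<n∨m≡n d₀≤1+N
  ... | inj₁ (s≤s d₀≤N) =
    cong₂ _+_ (∑₁-𝟙-≡ N 1≤d₀ d₀≤N) (𝟙-no (suc N ≟ d₀) (λ { refl → 1+n≰n d₀≤N }))
  ... | inj₂ refl =
    cong₂ _+_ (∑₁-zero N (λ {k} _ k≤N → 𝟙-no (k ≟ suc N) (λ { refl → 1+n≰n k≤N })))
              (𝟙-yes (suc N ≟ suc N) refl)

  ∑₁-multiples : ∀ g .{{_ : NonZero g}} e f → (∀ k → ¬ g ∣ k → f k ≡ 0) →
                 ∑₁ (e * g) f ≡ ∑₁ e (λ j → f (j * g))
  ∑₁-multiples g       zero    f f-off = refl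
  ∑₁-multiples (suc h) (suc e) f f-off = begin
    ∑₁ (g + e * g) f                                  ≡⟨ cong (λ N → ∑₁ N f) (+-comm g (e * g)) ⟩
    ∑₁ (e * g + g) f                                  ≡⟨ ∑₁-+ (e * g) g f ⟩
    ∑₁ (e * g) f + (∑₁ h (λ t → f (e * g + t)) + f (e * g + g))
      ≡⟨ cong₂ (λ s z → s + (z + f (e * g + g))) (∑₁-multiples g e f f-off) between ⟩
    ∑₁ e (λ j → f (j * g)) + f (e * g + g)
      ≡⟨ cong (λ k → ∑₁ e (λ j → f (j * g)) + f k) (+-comm (e * g) g) ⟩
    ∑₁ (suc e) (λ j → f (j * g))                      ∎
    where
    open ≡-Reasoning
    g = suc h
    between : ∑₁ h (λ t → f (e * g + t)) ≡ 0
    between = ∑₁-zero h λ {t} 1≤t t≤h → f-off (e * g + t) λ g∣ →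
      <⇒≱ (s≤s t≤h) (∣⇒≤ {{>-nonZero 1≤t}} (∣m+n∣m⇒∣n g∣ (n∣m*n e)))

  ∑₁-filter : ∀ {p} {P : Pred ℕ p} (P? : Decidable P) N f →
              sum (map f (filter P? (applyUpTo suc N))) ≡ ∑₁ N (λ k → 𝟙 (P? k) * f k)
  ∑₁-filter P? zero    f = refl
  ∑₁-filter P? (suc N) f = begin
    sum (map f (filter P? (applyUpTo suc (suc N))))
      ≡⟨ cong (sum ∘ map f ∘ filter P?) (sym (List.applyUpTo-∷ʳ suc N)) ⟩
    sum (map f (filter P? (applyUpTo suc N ++ suc N ∷ [])))
      ≡⟨ cong (sum ∘ map f) (List.filter-++ P? (applyUpTo suc N) _) ⟩
    sum (map f (filter P? (applyUpTo suc N) ++ filter P? (suc N ∷ [])))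
      ≡⟨ cong sum (List.map-++ f (filter P? (applyUpTo suc N)) _) ⟩
    sum (map f (filter P? (applyUpTo suc N)) ++ map f (filter P? (suc N ∷ [])))
      ≡⟨ sum-++ (map f (filter P? (applyUpTo suc N))) _ ⟩
    sum (map f (filter P? (applyUpTo suc N))) + sum (map f (filter P? (suc N ∷ [])))
      ≡⟨ cong₂ _+_ (∑₁-filter P? N f) (singleton (suc N)) ⟩
    ∑₁ (suc N) (λ k → 𝟙 (P? k) * f k) ∎
    where
    open ≡-Reasoning
    singleton : ∀ k → sum (map f (filter P? (k ∷ []))) ≡ 𝟙 (P? k) * f k
    singleton k with P? k
    ... | yes _ = refl
    ... | no _  = refl

  φ≡∑₁ : ∀ m → φ m ≡ ∑₁ m (λ k → 𝟙 (gcd k m ≟ 1))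
  φ≡∑₁ m = begin
    length (filter coprime? (map suc (upTo m)))
      ≡⟨ cong (length ∘ filter coprime?) (List.map-upTo suc m) ⟩
    length (filter coprime? (applyUpTo suc m))
      ≡⟨ length≡sum-map-1 (filter coprime? (applyUpTo suc m)) ⟩
    sum (map (λ _ → 1) (filter coprime? (applyUpTo suc m)))
      ≡⟨ ∑₁-filter coprime? m (λ _ → 1) ⟩
    ∑₁ m (λ k → 𝟙 (coprime? k) * 1)
      ≡⟨ ∑₁-cong m (λ _ _ → *-identityʳ _) ⟩
    ∑₁ m (λ k → 𝟙 (coprime? k))
      ∎
    where
    open ≡-Reasoning
    coprime? = λ k → gcd k m ≟ 1
    length≡sum-map-1 : ∀ {A : Set} (xs : List A) → length xs ≡ sum (map (λ _ → 1) xs)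
    length≡sum-map-1 []       = refl
    length≡sum-map-1 (x ∷ xs) = cong suc (length≡sum-map-1 xs)

  φ-positive : ∀ m → 1 ≤ m → 1 ≤ φ m
  φ-positive (suc m) _ = subst (1 ≤_) (sym (cong length 1-coprime)) (s≤s z≤n)
    where
    1-coprime = List.filter-accept (λ k → gcd k (suc m) ≟ 1) {x = 1} {xs = map suc (applyUpTo suc m)}
                                   (gcd-zeroˡ (suc m))

  -- gcd k m * d ≡ m says that d is the cofactor m / gcd k m; counting the pairs (k, d) in
  -- two ways gives divisor-sum-φ.
  ∑₁-gcd-cofactor≡1 : ∀ m k .{{_ : NonZero m}} → ∑₁ m (λ d → 𝟙 (gcd k m * d ≟ m)) ≡ 1
  ∑₁-gcd-cofactor≡1 m k with gcd[m,n]∣n k m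
  ... | divides d₀ m≡d₀g =
    trans (∑₁-cong m (λ _ _ → 𝟙-⇔ (gcd k m * _ ≟ m) (_ ≟ d₀) (mk⇔ cancel uncancel)))
          (∑₁-𝟙-≡ m 1≤d₀ d₀≤m)
    where
    g = gcd k m
    instance
      g≢0 : NonZero g
      g≢0 = ≢-nonZero (gcd[m,n]≢0 k m (inj₂ (≢-nonZero⁻¹ m)))
    cancel : ∀ {d} → g * d ≡ m → d ≡ d₀
    cancel {d} gd≡m = *-cancelˡ-≡ d d₀ g (trans gd≡m (trans m≡d₀g (*-comm d₀ g)))
    uncancel : ∀ {d} → d ≡ d₀ → g * d ≡ m
    uncancel refl = trans (*-comm g d₀) (sym m≡d₀g)
    1≤d₀ : 1 ≤ d₀
    1≤d₀ = n≢0⇒n>0 (λ { refl → ≢-nonZero⁻¹ m m≡d₀g })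
    d₀≤m : d₀ ≤ m
    d₀≤m = ∣⇒≤ (divides g (trans m≡d₀g (*-comm d₀ g)))

  ∑₁-gcd-cofactor≡φ : ∀ m d .{{_ : NonZero d}} .{{_ : NonZero m}} →
                      ∑₁ m (λ k → 𝟙 (gcd k m * d ≟ m)) ≡ 𝟙 (d ∣? m) * φ d
  ∑₁-gcd-cofactor≡φ m d with d ∣? m
  ... | no  d∤m =
    ∑₁-zero m (λ {k} _ _ → 𝟙-no (gcd k m * d ≟ m) (λ e → d∤m (divides (gcd k m) (sym e))))
  ... | yes (divides q refl) = begin
    ∑₁ (q * d) F                   ≡⟨ cong (λ N → ∑₁ N F) (*-comm q d) ⟩
    ∑₁ (d * q) F                   ≡⟨ ∑₁-multiples q d F F-off ⟩
    ∑₁ d (λ j → F (j * q))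
      ≡⟨ ∑₁-cong d (λ {j} _ _ → 𝟙-⇔ (gcd (j * q) m * d ≟ m) (gcd j d ≟ 1) (gcd-scaled j)) ⟩
    ∑₁ d (λ j → 𝟙 (gcd j d ≟ 1))   ≡⟨ φ≡∑₁ d ⟨
    φ d                            ≡⟨ +-identityʳ (φ d) ⟨
    1 * φ d                        ∎
    where
    open ≡-Reasoning
    F = λ k → 𝟙 (gcd k m * d ≟ m)
    instance
      q≢0 : NonZero q
      q≢0 = m*n≢0⇒m≢0 q
    F-off : ∀ k → ¬ q ∣ k → F k ≡ 0
    F-off k q∤k = 𝟙-no (gcd k m * d ≟ m) λ e →
      q∤k (subst (_∣ k) (*-cancelʳ-≡ (gcd k m) q d e) (gcd[m,n]∣m k m))
    gcd-jq : ∀ j → gcd (j * q) m ≡ q * gcd j d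
    gcd-jq j = trans (cong (λ t → gcd t m) (*-comm j q)) (sym (c*gcd[m,n]≡gcd[cm,cn] q j d))
    gcd-scaled : ∀ j → (gcd (j * q) m * d ≡ m) ⇔ (gcd j d ≡ 1)
    gcd-scaled j = mk⇔
      (λ e → *-cancelˡ-≡ (gcd j d) 1 q
               (trans (sym (gcd-jq j)) (trans (*-cancelʳ-≡ _ q d e) (sym (*-identityʳ q)))))
      (λ e → cong (_* d) (trans (gcd-jq j) (trans (cong (q *_) e) (*-identityʳ q))))

  divisor-sum-φ : ∀ m .{{_ : NonZero m}} → ∑₁ m (λ d → 𝟙 (d ∣? m) * φ d) ≡ m
  divisor-sum-φ m = begin
    ∑₁ m (λ d → 𝟙 (d ∣? m) * φ d)     ≡⟨ ∑₁-cong m (λ {d} 1≤d _ → ∑₁-gcd-cofactor≡φ m d {{>-nonZero 1≤d}}) ⟨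
    ∑₁ m (λ d → ∑₁ m (λ k → T k d))   ≡⟨ ∑₁-comm m m (λ d k → T k d) ⟩
    ∑₁ m (λ k → ∑₁ m (λ d → T k d))   ≡⟨ ∑₁-cong m (λ {k} _ _ → ∑₁-gcd-cofactor≡1 m k) ⟩
    ∑₁ m (λ _ → 1)                    ≡⟨ ∑₁-const-1 m ⟩
    m                                 ∎
    where
    open ≡-Reasoning
    T = λ k d → 𝟙 (gcd k m * d ≟ m)

module CyclotomicDegree where

  open DivisorSum
  open import Data.Integer.Base as ℤ using (ℤ; 0ℤ)
  open import Data.List.Base
    using (List; []; _∷_; _++_; map; filter; applyUpTo; upTo; length; reverse; replicate; zip)
  import Data.List.Properties as List
  open import Data.List.Relation.Unary.All using (All; []; _∷_)
  open import Data.List.Relation.Unary.All.Properties using (applyUpTo⁺₁; filter⁺)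
  open import Data.Nat.Base using (ℕ; zero; suc; _+_; _*_; _∸_; _⊔_; _≤_; _<_; z≤n; s≤s)
  open import Data.Nat.Properties
  open import Data.Nat.Divisibility using (_∣?_; ∣-refl)
  open import Data.Nat.Induction using (<-rec)
  open import Data.Nat.ListAction using (sum)
  open import Data.Product.Base using (_×_; proj₁; proj₂)
  open import Function.Base using (_∘_)
  open import Relation.Nullary.Decidable using (yes; no)
  open import Relation.Unary using (Pred; Decidable)

  length-addL : ∀ xs ys → length (addL xs ys) ≡ length xs ⊔ length ys
  length-addL []       ys       = refl
  length-addL (x ∷ xs) []       = refl
  length-addL (x ∷ xs) (y ∷ ys) = cong suc (length-addL xs ys)

  length-mulL-∷ : ∀ x p y q → length (mulL (x ∷ p) (y ∷ q)) ≡ suc (length p + length q)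
  length-mulL-∷ x [] y q = cong suc (begin
    length (addL (map (x ℤ.*_) q) [])   ≡⟨ length-addL (map (x ℤ.*_) q) [] ⟩
    length (map (x ℤ.*_) q) ⊔ 0         ≡⟨ ⊔-identityʳ _ ⟩
    length (map (x ℤ.*_) q)             ≡⟨ List.length-map (x ℤ.*_) q ⟩
    length q                            ∎)
    where open ≡-Reasoning
  length-mulL-∷ x (z ∷ p) y q = cong suc (begin
    length (addL (map (x ℤ.*_) q) (mulL (z ∷ p) (y ∷ q)))
      ≡⟨ length-addL (map (x ℤ.*_) q) _ ⟩
    length (map (x ℤ.*_) q) ⊔ length (mulL (z ∷ p) (y ∷ q))
      ≡⟨ cong₂ _⊔_ (List.length-map (x ℤ.*_) q) (length-mulL-∷ z p y q) ⟩
    length q ⊔ suc (length p + length q)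
      ≡⟨ m≤n⇒m⊔n≡n (≤-trans (m≤n+m (length q) (length p)) (n≤1+n _)) ⟩
    suc (length p + length q)
      ∎)
    where open ≡-Reasoning

  length-mulL : ∀ {a b} p q → length p ≡ suc a → length q ≡ suc b → length (mulL p q) ≡ suc (a + b)
  length-mulL (x ∷ p) (y ∷ q) refl refl = length-mulL-∷ x p y q

  length-prodL : ∀ {A : Set} (P : A → List ℤ) (deg : A → ℕ) {xs} →
                 All (λ x → length (P x) ≡ suc (deg x)) xs →
                 length (prodL (map P xs)) ≡ suc (sum (map deg xs))
  length-prodL P deg             []         = refl
  length-prodL P deg {x ∷ xs} (px ∷ pxs) =
    length-mulL (P x) (prodL (map P xs)) px (length-prodL P deg pxs)

  length-subPrefix : ∀ xs ys → length ys ≤ length (subPrefix xs ys)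
  length-subPrefix []       ys       = ≤-refl
  length-subPrefix (x ∷ xs) []       = z≤n
  length-subPrefix (x ∷ xs) (y ∷ ys) = s≤s (length-subPrefix xs ys)

  length-divMonicGo : ∀ f qs r → f ≤ length r → length (divMonicGo f qs r) ≡ f
  length-divMonicGo zero    qs r       _         = refl
  length-divMonicGo (suc f) qs (t ∷ r) (s≤s f≤r) =
    cong suc (length-divMonicGo f qs _ (≤-trans f≤r (length-subPrefix (map (t ℤ.*_) qs) r)))

  length-divMonic : ∀ {d} p q → length q ≡ suc d → length (divMonic p q) ≡ length p ∸ d
  length-divMonic p (_ ∷ qs) refl =
    length-divMonicGo (length p ∸ length qs) qs p (m∸n≤m (length p) (length qs))

  length-xm1 : ∀ k → length (xm1 (suc k)) ≡ suc (suc k)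
  length-xm1 k = cong suc (begin
    length (replicate k 0ℤ ++ ℤ.+ 1 ∷ [])   ≡⟨ List.length-++ (replicate k 0ℤ) ⟩
    length (replicate k 0ℤ) + 1             ≡⟨ cong (_+ 1) (List.length-replicate k) ⟩
    k + 1                                   ≡⟨ +-comm k 1 ⟩
    suc k                                   ∎)
    where open ≡-Reasoning

  cyclos≡map-cyclo : ∀ k → cyclos k ≡ map cyclo (applyUpTo suc k)
  cyclos≡map-cyclo zero    = refl
  cyclos≡map-cyclo (suc k) = begin
    cyclos k ++ cyclo (suc k) ∷ []
      ≡⟨ cong (_++ cyclo (suc k) ∷ []) (cyclos≡map-cyclo k) ⟩
    map cyclo (applyUpTo suc k) ++ map cyclo (suc k ∷ [])
      ≡⟨ List.map-++ cyclo (applyUpTo suc k) _ ⟨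
    map cyclo (applyUpTo suc k ++ suc k ∷ [])
      ≡⟨ cong (map cyclo) (List.applyUpTo-∷ʳ suc k) ⟩
    map cyclo (applyUpTo suc (suc k))
      ∎
    where open ≡-Reasoning

  filter-graph : ∀ {A B : Set} {p} {P : Pred A p} (P? : Decidable P) (g : A → B) xs →
                 map proj₂ (filter (P? ∘ proj₁) (zip xs (map g xs))) ≡ map g (filter P? xs)
  filter-graph P? g []       = refl
  filter-graph P? g (x ∷ xs) with P? x
  ... | yes _ = cong (g x ∷_) (filter-graph P? g xs)
  ... | no  _ = filter-graph P? g xs

  properDivisorPolys-cyclos : ∀ m k →
    properDivisorPolys m (cyclos k) ≡ map cyclo (filter (_∣? m) (applyUpTo suc k))
  properDivisorPolys-cyclos m k = begin
    map proj₂ (filter divides-m? (zip (map suc (upTo (length (cyclos k)))) (cyclos k)))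
      ≡⟨ cong (λ l → map proj₂ (filter divides-m? (zip (map suc (upTo l)) (cyclos k)))) length-cyclos ⟩
    map proj₂ (filter divides-m? (zip (map suc (upTo k)) (cyclos k)))
      ≡⟨ cong₂ (λ ds ps → map proj₂ (filter divides-m? (zip ds ps)))
               (List.map-upTo suc k) (cyclos≡map-cyclo k) ⟩
    map proj₂ (filter divides-m? (zip (applyUpTo suc k) (map cyclo (applyUpTo suc k))))
      ≡⟨ filter-graph (_∣? m) cyclo (applyUpTo suc k) ⟩
    map cyclo (filter (_∣? m) (applyUpTo suc k))
      ∎
    where
    open ≡-Reasoning
    divides-m? = λ (dp : ℕ × List ℤ) → proj₁ dp ∣? m
    length-cyclos : length (cyclos k) ≡ k
    length-cyclos = trans (cong length (cyclos≡map-cyclo k))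
                          (trans (List.length-map cyclo (applyUpTo suc k)) (List.length-applyUpTo suc k))

  length-cyclo-suc : ∀ k → (∀ {d} → 1 ≤ d → d ≤ k → length (cyclo d) ≡ suc (φ d)) →
                     length (cyclo (suc k)) ≡ suc (φ (suc k))
  length-cyclo-suc k IH = begin
    length (reverse (divMonic (reverse (xm1 (suc k))) (reverse (prodL PD))))
      ≡⟨ List.length-reverse (divMonic (reverse (xm1 (suc k))) (reverse (prodL PD))) ⟩
    length (divMonic (reverse (xm1 (suc k))) (reverse (prodL PD)))
      ≡⟨ length-divMonic _ (reverse (prodL PD)) (trans (List.length-reverse (prodL PD)) length-prodL-PD) ⟩
    length (reverse (xm1 (suc k))) ∸ S
      ≡⟨ cong (_∸ S) (trans (List.length-reverse (xm1 (suc k))) (length-xm1 k)) ⟩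
    suc (suc k) ∸ S                     ≡⟨ cong (λ t → suc t ∸ S) divisor-sum ⟨
    suc (S + φ (suc k)) ∸ S             ≡⟨ cong (_∸ S) (+-suc S (φ (suc k))) ⟨
    S + suc (φ (suc k)) ∸ S             ≡⟨ m+n∸m≡n S (suc (φ (suc k))) ⟩
    suc (φ (suc k))                     ∎
    where
    open ≡-Reasoning
    PD = properDivisorPolys (suc k) (cyclos k)
    ds = filter (_∣? suc k) (applyUpTo suc k)
    S  = ∑₁ k (λ d → 𝟙 (d ∣? suc k) * φ d)
    length-prodL-PD : length (prodL PD) ≡ suc S
    length-prodL-PD = begin
      length (prodL PD)
        ≡⟨ cong (length ∘ prodL) (properDivisorPolys-cyclos (suc k) k) ⟩
      length (prodL (map cyclo ds))
        ≡⟨ length-prodL cyclo φ (filter⁺ (_∣? suc k) (applyUpTo⁺₁ suc k (IH (s≤s z≤n)))) ⟩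
      suc (sum (map φ ds))
        ≡⟨ cong suc (∑₁-filter (_∣? suc k) k φ) ⟩
      suc S
        ∎
    divisor-sum : S + φ (suc k) ≡ suc k
    divisor-sum = begin
      S + φ (suc k)
        ≡⟨ cong (S +_) (*-identityˡ (φ (suc k))) ⟨
      S + 1 * φ (suc k)
        ≡⟨ cong (λ t → S + t * φ (suc k)) (𝟙-yes (suc k ∣? suc k) ∣-refl) ⟨
      ∑₁ (suc k) (λ d → 𝟙 (d ∣? suc k) * φ d)
        ≡⟨ divisor-sum-φ (suc k) ⟩
      suc k
        ∎

  length-cyclo : ∀ m → 1 ≤ m → length (cyclo m) ≡ suc (φ m)
  length-cyclo = <-rec _ step
    where
    step : ∀ m → (∀ {d} → d < m → 1 ≤ d → length (cyclo d) ≡ suc (φ d)) →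
           1 ≤ m → length (cyclo m) ≡ suc (φ m)
    step (suc k) IH _ = length-cyclo-suc k (λ 1≤d d≤k → IH (s≤s d≤k) 1≤d)

module PowerBasis where

  open CyclotomicDegree using (length-cyclo)
  open import Algebra.Properties.CommutativeSemigroup using (interchange)
  open import Data.Fin.Base using (Fin; toℕ)
  import Data.Fin.Base as Fin using (zero; suc)
  open import Data.Integer.Base using (ℤ; 0ℤ; 1ℤ; +_; _+_; _-_; _*_; -_; _^_)
  open import Data.Integer.Properties
    using (*-zeroˡ; *-identityˡ; *-identityʳ; +-identityˡ; +-identityʳ; +-comm; +-assoc;
           *-distribʳ-+; neg-distrib-+; +-commutativeSemigroup)
  open import Data.Integer.Tactic.RingSolver using (solve-∀)
  open import Data.List.Base using (List; []; _∷_; _++_; _∷ʳ_; map; length; reverse; replicate)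
  import Data.List.Properties as List
  open import Data.Nat.Base as ℕ using (ℕ; zero; suc; _∸_; _≤_; _<_; z≤n; s≤s)
  import Data.Nat.Properties as ℕ
  open import Function.Base using (_∘_)

  monomial : ℕ → ℤ → ℕ → List ℤ
  monomial i x t = replicate i 0ℤ ++ x ∷ replicate t 0ℤ

  replicate-∷ʳ : ∀ {A : Set} n (x : A) → replicate n x ++ x ∷ [] ≡ x ∷ replicate n x
  replicate-∷ʳ zero    x = refl
  replicate-∷ʳ (suc n) x = cong (x ∷_) (replicate-∷ʳ n x)

  reverse-replicate : ∀ {A : Set} n (x : A) → reverse (replicate n x) ≡ replicate n x
  reverse-replicate zero    x = refl
  reverse-replicate (suc n) x = begin
    reverse (x ∷ replicate n x)   ≡⟨ List.unfold-reverse x (replicate n x) ⟩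
    reverse (replicate n x) ∷ʳ x  ≡⟨ cong (_∷ʳ x) (reverse-replicate n x) ⟩
    replicate n x ∷ʳ x            ≡⟨ replicate-∷ʳ n x ⟩
    replicate (suc n) x           ∎
    where open ≡-Reasoning

  reverse-monomial : ∀ i x t → reverse (replicate t 0ℤ ++ x ∷ replicate i 0ℤ) ≡ monomial i x t
  reverse-monomial i x t = begin
    reverse (replicate t 0ℤ ++ x ∷ replicate i 0ℤ)
      ≡⟨ List.reverse-++ (replicate t 0ℤ) (x ∷ replicate i 0ℤ) ⟩
    reverse (x ∷ replicate i 0ℤ) ++ reverse (replicate t 0ℤ)
      ≡⟨ cong₂ _++_ (List.unfold-reverse x (replicate i 0ℤ)) (reverse-replicate t 0ℤ) ⟩
    (reverse (replicate i 0ℤ) ∷ʳ x) ++ replicate t 0ℤ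
      ≡⟨ cong (λ l → (l ∷ʳ x) ++ replicate t 0ℤ) (reverse-replicate i 0ℤ) ⟩
    (replicate i 0ℤ ∷ʳ x) ++ replicate t 0ℤ
      ≡⟨ List.++-assoc (replicate i 0ℤ) (x ∷ []) _ ⟩
    monomial i x t
      ∎
    where open ≡-Reasoning

  subPrefix-0* : ∀ qs ys → length qs ≤ length ys → subPrefix (map (0ℤ *_) qs) ys ≡ ys
  subPrefix-0* []       ys       _         = refl
  subPrefix-0* (q ∷ qs) (y ∷ ys) (s≤s q≤y) =
    cong₂ _∷_ (trans (cong (λ z → y - z) (*-zeroˡ q)) (+-identityʳ y)) (subPrefix-0* qs ys q≤y)

  module _ {m p : ℕ} (length-Φ : length (cyclo m) ≡ suc (suc p)) where

    -- Below the degree p + 1 of Φ_m, multiplying by x never triggers a reduction.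
    xPowMod-monomial : ∀ i t → i ℕ.+ t ≡ p → xPowMod m i ≡ replicate t 0ℤ ++ 1ℤ ∷ replicate i 0ℤ
    xPowMod-monomial zero t refl = begin
      reverse (1ℤ ∷ replicate (length (cyclo m) ∸ 2) 0ℤ)
        ≡⟨ cong (λ l → reverse (1ℤ ∷ replicate (l ∸ 2) 0ℤ)) length-Φ ⟩
      reverse (1ℤ ∷ replicate t 0ℤ)
        ≡⟨ reverse-monomial t 1ℤ 0 ⟩
      replicate t 0ℤ ++ 1ℤ ∷ []
        ∎
      where open ≡-Reasoning
    xPowMod-monomial (suc i) t i+t≡p
      rewrite xPowMod-monomial i (suc t) (trans (ℕ.+-suc i t) i+t≡p)
            | List.++-assoc (replicate t 0ℤ) (1ℤ ∷ replicate i 0ℤ) (0ℤ ∷ [])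
            | replicate-∷ʳ i 0ℤ
      with reverse (cyclo m) | trans (List.length-reverse (cyclo m)) length-Φ
    ... | _ ∷ qs | length-rev = subPrefix-0* qs _ (ℕ.≤-reflexive (begin
      length qs                                              ≡⟨ ℕ.suc-injective length-rev ⟩
      suc p                                                  ≡⟨ cong suc i+t≡p ⟨
      suc (suc i ℕ.+ t)                                      ≡⟨ ℕ.+-comm (suc (suc i)) t ⟩
      t ℕ.+ suc (suc i)                                      ≡⟨ cong₂ ℕ._+_ length-zeros length-rest ⟨
      length zeros ℕ.+ length (1ℤ ∷ replicate (suc i) 0ℤ)    ≡⟨ List.length-++ zeros ⟨
      length (zeros ++ 1ℤ ∷ replicate (suc i) 0ℤ)            ∎))
      where
      open ≡-Reasoning
      zeros = replicate t 0ℤ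
      length-zeros = List.length-replicate t
      length-rest = cong suc (List.length-replicate (suc i))

    c-monomial : ∀ {i} → i ≤ p → ∀ j → c m i j ≡ lookup0 (monomial i 1ℤ (p ∸ i)) j
    c-monomial {i} i≤p j = cong (λ l → lookup0 l j) (begin
      reverse (xPowMod m i)
        ≡⟨ cong reverse (xPowMod-monomial i (p ∸ i) (ℕ.m+[n∸m]≡n i≤p)) ⟩
      reverse (replicate (p ∸ i) 0ℤ ++ 1ℤ ∷ replicate i 0ℤ)
        ≡⟨ reverse-monomial i 1ℤ (p ∸ i) ⟩
      monomial i 1ℤ (p ∸ i)
        ∎)
      where open ≡-Reasoning

  sumFin-cong : ∀ k {f g : Fin k → ℤ} → (∀ j → f j ≡ g j) → sumFin k f ≡ sumFin k g
  sumFin-cong zero    f≗g = refl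
  sumFin-cong (suc k) f≗g = cong₂ _+_ (f≗g Fin.zero) (sumFin-cong k (f≗g ∘ Fin.suc))

  sumFin-zero : ∀ k {f : Fin k → ℤ} → (∀ j → f j ≡ 0ℤ) → sumFin k f ≡ 0ℤ
  sumFin-zero zero    f≗0 = refl
  sumFin-zero (suc k) f≗0 = cong₂ _+_ (f≗0 Fin.zero) (sumFin-zero k (f≗0 ∘ Fin.suc))

  sumFin-distrib-+ : ∀ k (f g : Fin k → ℤ) → sumFin k (λ j → f j + g j) ≡ sumFin k f + sumFin k g
  sumFin-distrib-+ zero    f g = refl
  sumFin-distrib-+ (suc k) f g =
    trans (cong (λ s → (f Fin.zero + g Fin.zero) + s) (sumFin-distrib-+ k (f ∘ Fin.suc) (g ∘ Fin.suc)))
          (interchange +-commutativeSemigroup (f Fin.zero) (g Fin.zero) (sumFin k (f ∘ Fin.suc))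
                                              (sumFin k (g ∘ Fin.suc)))

  sumFin-neg : ∀ k (f : Fin k → ℤ) → sumFin k (λ j → - f j) ≡ - sumFin k f
  sumFin-neg zero    f = refl
  sumFin-neg (suc k) f =
    trans (cong (λ s → (- f Fin.zero) + s) (sumFin-neg k (f ∘ Fin.suc)))
          (sym (neg-distrib-+ (f Fin.zero) _))

  sumFin≡sumℕ : ∀ k (g : ℕ → ℤ) → sumFin k (g ∘ toℕ) ≡ sumℕ k g
  sumFin≡sumℕ zero    g = refl
  sumFin≡sumℕ (suc k) g = trans (cong (λ s → g 0 + s) (sumFin≡sumℕ k (g ∘ suc))) (sumℕ-suc k g)
    where
    sumℕ-suc : ∀ k g → g 0 + sumℕ k (g ∘ suc) ≡ sumℕ (suc k) g
    sumℕ-suc zero    g = +-comm (g 0) 0ℤ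
    sumℕ-suc (suc k) g = trans (sym (+-assoc (g 0) _ _)) (cong (_+ g (suc k)) (sumℕ-suc k g))

  lookup0-replicate-0 : ∀ t j → lookup0 (replicate t 0ℤ) j ≡ 0ℤ
  lookup0-replicate-0 zero    j       = refl
  lookup0-replicate-0 (suc t) zero    = refl
  lookup0-replicate-0 (suc t) (suc j) = lookup0-replicate-0 t j

  sumFin-monomial : ∀ {k} i x t (h : ℕ → ℤ) → i < k →
                    sumFin k (λ j → lookup0 (monomial i x t) (toℕ j) * h (toℕ j)) ≡ x * h i
  sumFin-monomial {suc k} zero x t h _ =
    trans (cong (λ s → x * h 0 + s) (sumFin-zero k vanish)) (+-identityʳ (x * h 0))
    where
    vanish : ∀ j → lookup0 (replicate t 0ℤ) (toℕ j) * h (suc (toℕ j)) ≡ 0ℤ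
    vanish j = trans (cong (_* h (suc (toℕ j))) (lookup0-replicate-0 t (toℕ j))) (*-zeroˡ (h (suc (toℕ j))))
  sumFin-monomial {suc k} (suc i) x t h (s≤s i<k) =
    trans (cong (_+ rest) (*-zeroˡ (h 0))) (trans (+-identityˡ rest) (sumFin-monomial i x t (h ∘ suc) i<k))
    where rest = sumFin k (λ j → lookup0 (monomial i x t) (toℕ j) * h (suc (toℕ j)))

  evalAt : ∀ {k} → ℤ → (Fin k → ℤ) → ℤ
  evalAt {k} x v = sumFin k (λ j → v j * x ^ toℕ j)

  evalAt-⊕ : ∀ {k} x (u v : Fin k → ℤ) → evalAt x (u ⊕ v) ≡ evalAt x u + evalAt x v
  evalAt-⊕ {k} x u v =
    trans (sumFin-cong k (λ j → *-distribʳ-+ (x ^ toℕ j) (u j) (v j)))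
          (sumFin-distrib-+ k (λ j → u j * x ^ toℕ j) (λ j → v j * x ^ toℕ j))

  evalAt-⊖ : ∀ {k} x (u v : Fin k → ℤ) → evalAt x (u ⊖ v) ≡ evalAt x u - evalAt x v
  evalAt-⊖ {k} x u v = begin
    sumFin k (λ j → (u j - v j) * x ^ toℕ j)
      ≡⟨ sumFin-cong k (λ j → distrib (u j) (v j) (x ^ toℕ j)) ⟩
    sumFin k (λ j → u j * x ^ toℕ j + - (v j * x ^ toℕ j))
      ≡⟨ sumFin-distrib-+ k _ _ ⟩
    evalAt x u + sumFin k (λ j → - (v j * x ^ toℕ j))
      ≡⟨ cong (λ s → evalAt x u + s) (sumFin-neg k _) ⟩
    evalAt x u - evalAt x v
      ∎
    where
    open ≡-Reasoning
    distrib : ∀ a b w → (a - b) * w ≡ a * w + - (b * w)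
    distrib = solve-∀

  embed : ∀ {k} → ℤ → Fin k → ℤ
  embed x j = lookup0 (x ∷ []) (toℕ j)

  evalAt-embed : ∀ {k} x y → 1 ≤ k → evalAt {k} x (embed y) ≡ y
  evalAt-embed x y 1≤k = trans (sumFin-monomial 0 y 0 (x ^_) 1≤k) (*-identityʳ y)

  evalAt-ζ^ : ∀ {m} x {i} → 1 ≤ m → i < φ m → evalAt x (ζ^ m i) ≡ x ^ i
  evalAt-ζ^ {m} x {i} 1≤m i<φ = begin
    sumFin (φ m) (λ j → c m i (toℕ j) * x ^ toℕ j)
      ≡⟨ sumFin-cong (φ m) (λ j → cong (_* x ^ toℕ j) (c-monomial length-Φ i≤p (toℕ j))) ⟩
    sumFin (φ m) (λ j → lookup0 (monomial i 1ℤ (p ∸ i)) (toℕ j) * x ^ toℕ j)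
      ≡⟨ sumFin-monomial i 1ℤ (p ∸ i) (x ^_) i<φ ⟩
    1ℤ * x ^ i
      ≡⟨ *-identityˡ (x ^ i) ⟩
    x ^ i
      ∎
    where
    open ≡-Reasoning
    p = ℕ.pred (φ m)
    φ≡1+p : φ m ≡ suc p
    φ≡1+p = sym (ℕ.suc-pred (φ m) {{ℕ.>-nonZero (ℕ.<-≤-trans (s≤s z≤n) i<φ)}})
    i≤p : i ≤ p
    i≤p = ℕ.≤-pred (subst (i <_) φ≡1+p i<φ)
    length-Φ : length (cyclo m) ≡ suc (suc p)
    length-Φ = trans (length-cyclo m 1≤m) (cong suc φ≡1+p)

module CayleyGraph where

  open PowerBasis using (evalAt; evalAt-⊖; evalAt-⊕; embed; evalAt-embed)
  open import Data.Fin.Base using (Fin; toℕ; fromℕ<)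
  open import Data.Fin.Properties using (toℕ<n; toℕ-fromℕ<; toℕ-injective)
  open import Data.Integer.Base as ℤ using (ℤ; 0ℤ; 1ℤ; +_; _+_; _-_; _*_; -_; _^_; _%ℕ_; _/ℕ_)
  open import Data.Integer.Properties
    using (+-inverseʳ; +-identityʳ; neg-involutive; neg-distribˡ-*; ^-distribˡ-+-*; +-injective;
           i-j≡0⇒i≡j; ∣i∣≡0⇒i≡0; m-n≡m⊖n; ∣m⊝n∣≤m⊔n)
  open import Data.Integer.DivMod using (a≡a%ℕn+[a/ℕn]*n; n%ℕd<d)
  import Data.Integer.Divisibility.Signed as Signed
  open import Data.Integer.Tactic.RingSolver using (solve-∀)
  open import Data.Nat.Base as ℕ using (ℕ; zero; suc; _≤_; _<_; _%_; _/_; NonZero)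
  import Data.Nat.Properties as ℕ
  open import Data.Nat.Divisibility as ℕ using (>⇒∤)
  open import Data.Nat.DivMod using (m≡m%n+[m/n]*n)
  open import Data.Product.Base as Product using (_×_; _,_; ∃-syntax)
  open import Data.Sum.Base using (_⊎_; inj₁; inj₂)
  open import Data.Sum.Function.Propositional using (_⊎-⇔_)
  open import Function.Base using (_∘_)
  open import Function.Bundles using (_⇔_; mk⇔; Equivalence)
  open import Function.Construct.Composition using (_⇔-∘_)
  open import Relation.Binary.Bundles using (Setoid)
  open import Relation.Binary.Structures using (IsEquivalence)
  import Relation.Binary.Reasoning.Setoid as ≈-Reasoning
  open import Relation.Nullary.Negation using (contradiction)

  -‿^-odd : ∀ x h → (- x) ^ (1 ℕ.+ h ℕ.* 2) ≡ - (x ^ (1 ℕ.+ h ℕ.* 2))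
  -‿^-odd x zero    = neg-*-1 x
    where
    neg-*-1 : ∀ x → - x * 1ℤ ≡ - (x * 1ℤ)
    neg-*-1 = solve-∀
  -‿^-odd x (suc h) = trans (cong (λ e → - x * (- x * e)) (-‿^-odd x h)) (neg-twice x (x ^ (1 ℕ.+ h ℕ.* 2)))
    where
    neg-twice : ∀ x y → - x * (- x * - y) ≡ - (x * (x * y))
    neg-twice = solve-∀

  -‿^-sign : ∀ x k → (- x) ^ k ≡ x ^ k ⊎ (- x) ^ k ≡ - (x ^ k)
  -‿^-sign x zero = inj₁ refl
  -‿^-sign x (suc k) with -‿^-sign x k
  ... | inj₁ e = inj₂ (trans (cong (- x *_) e) (sym (neg-distribˡ-* x (x ^ k))))
  ... | inj₂ e = inj₁ (trans (cong (- x *_) e) (neg-*-neg x (x ^ k)))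
    where
    neg-*-neg : ∀ x y → - x * - y ≡ x * y
    neg-*-neg = solve-∀

  module Congruence (n : ℕ) where

    -- A record rather than a synonym for x ≡ y [mod n ], so that x and y can be inferred.
    infix 4 _≈_
    record _≈_ (x y : ℤ) : Set where
      constructor fromMod
      field toMod : x ≡ y [mod n ]
    open _≈_ public

    private
      fromSigned : ∀ {x y} → + n Signed.∣ x - y → x ≈ y
      fromSigned = fromMod ∘ Signed.∣⇒∣ᵤ

      toSigned : ∀ {x y} → x ≈ y → + n Signed.∣ x - y
      toSigned = Signed.∣ᵤ⇒∣ ∘ toMod

    ≈-refl : ∀ {x} → x ≈ x
    ≈-refl {x} = fromSigned (Signed.divides 0ℤ (+-inverseʳ x))

    ≈-reflexive : ∀ {x y} → x ≡ y → x ≈ y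
    ≈-reflexive refl = ≈-refl

    ≈-sym : ∀ {x y} → x ≈ y → y ≈ x
    ≈-sym {x} {y} x≈y = fromSigned (subst (+ n Signed.∣_) (flip x y) (Signed.∣m⇒∣-m (toSigned x≈y)))
      where
      flip : ∀ x y → - (x - y) ≡ y - x
      flip = solve-∀

    ≈-trans : ∀ {x y z} → x ≈ y → y ≈ z → x ≈ z
    ≈-trans {x} {y} {z} x≈y y≈z =
      fromSigned (subst (+ n Signed.∣_) (telescope x y z) (Signed.∣m∣n⇒∣m+n (toSigned x≈y) (toSigned y≈z)))
      where
      telescope : ∀ x y z → (x - y) + (y - z) ≡ x - z
      telescope = solve-∀

    ≈-isEquivalence : IsEquivalence _≈_
    ≈-isEquivalence = record { refl = ≈-refl ; sym = ≈-sym ; trans = ≈-trans }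

    ≈-setoid : Setoid _ _
    ≈-setoid = record { isEquivalence = ≈-isEquivalence }

    -‿cong : ∀ {x y} → x ≈ y → - x ≈ - y
    -‿cong {x} {y} x≈y = fromSigned (subst (+ n Signed.∣_) (neg-sub x y) (Signed.∣m⇒∣-m (toSigned x≈y)))
      where
      neg-sub : ∀ x y → - (x - y) ≡ - x - - y
      neg-sub = solve-∀

    *-congˡ : ∀ z {x y} → x ≈ y → z * x ≈ z * y
    *-congˡ z {x} {y} x≈y =
      fromSigned (subst (+ n Signed.∣_) (distrib z x y) (Signed.∣n⇒∣m*n z (toSigned x≈y)))
      where
      distrib : ∀ z x y → z * (x - y) ≡ z * x - z * y
      distrib = solve-∀

    ≈-cong⇔ : ∀ {x x′ y y′} → x ≈ x′ → y ≈ y′ → x ≈ y ⇔ x′ ≈ y′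
    ≈-cong⇔ x≈x′ y≈y′ = mk⇔ (λ x≈y → ≈-trans (≈-sym x≈x′) (≈-trans x≈y y≈y′))
                            (λ x′≈y′ → ≈-trans x≈x′ (≈-trans x′≈y′ (≈-sym y≈y′)))

    -≈0⇔≈ : ∀ {x y} → x - y ≈ 0ℤ ⇔ x ≈ y
    -≈0⇔≈ {x} {y} = mk⇔ (fromSigned ∘ subst (+ n Signed.∣_) (+-identityʳ (x - y)) ∘ toSigned)
                         (fromSigned ∘ subst (+ n Signed.∣_) (sym (+-identityʳ (x - y))) ∘ toSigned)

    ≈-%ℕ : .{{_ : NonZero n}} → ∀ x → x ≈ + (x %ℕ n)
    ≈-%ℕ x = fromSigned (Signed.divides (x /ℕ n) (begin
      x - + (x %ℕ n)                             ≡⟨ cong (_- + (x %ℕ n)) (a≡a%ℕn+[a/ℕn]*n x n) ⟩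
      + (x %ℕ n) + (x /ℕ n) * + n - + (x %ℕ n)   ≡⟨ cancel (+ (x %ℕ n)) ((x /ℕ n) * + n) ⟩
      (x /ℕ n) * + n                             ∎))
      where
      open ≡-Reasoning
      cancel : ∀ r s → r + s - r ≡ s
      cancel = solve-∀

    ≈⇒≡ : ∀ {x y} → x < n → y < n → + x ≈ + y → x ≡ y
    ≈⇒≡ {x} {y} x<n y<n +x≈+y =
      +-injective (i-j≡0⇒i≡j (+ x) (+ y) (∣i∣≡0⇒i≡0 (multiple-below-n (toMod +x≈+y) distance<n)))
      where
      multiple-below-n : ∀ {d} → n ℕ.∣ d → d < n → d ≡ 0
      multiple-below-n {zero}  _   _   = refl
      multiple-below-n {suc d} n∣d d<n = contradiction n∣d (>⇒∤ d<n)
      distance<n : ℤ.∣ + x - + y ∣ < n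
      distance<n = ℕ.≤-<-trans (ℕ.≤-reflexive (cong ℤ.∣_∣ (m-n≡m⊖n x y)))
                               (ℕ.≤-<-trans (∣m⊝n∣≤m⊔n x y) (ℕ.⊔-lub x<n y<n))

    module PowersOfNegation {m : ℕ} (m-odd : m % 2 ≡ 1) {A : ℤ} (A^m≈1 : A ^ m ≈ 1ℤ) where

      0<m : 0 < m
      0<m = ℕ.n≢0⇒n>0 λ { refl → ℕ.0≢1+n m-odd }

      ^-reduce : ∀ k → ∃[ r ] r < m × A ^ k ≈ A ^ r
      ^-reduce zero = 0 , 0<m , ≈-refl
      ^-reduce (suc k) with ^-reduce k
      ... | r , r<m , A^k≈A^r with ℕ.m≤n⇒m<n∨m≡n r<m
      ... | inj₁ 1+r<m = suc r , 1+r<m , *-congˡ A A^k≈A^r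
      ... | inj₂ 1+r≡m = 0 , 0<m , ≈-trans (*-congˡ A A^k≈A^r) (subst (λ e → A ^ e ≈ 1ℤ) (sym 1+r≡m) A^m≈1)

      [-A]^m≈-1 : (- A) ^ m ≈ - 1ℤ
      [-A]^m≈-1 = ≈-trans (≈-reflexive (begin
        (- A) ^ m                 ≡⟨ cong ((- A) ^_) m≡1+h*2 ⟩
        (- A) ^ (1 ℕ.+ h ℕ.* 2)   ≡⟨ -‿^-odd A h ⟩
        - (A ^ (1 ℕ.+ h ℕ.* 2))   ≡⟨ cong (λ e → - (A ^ e)) m≡1+h*2 ⟨
        - (A ^ m)                 ∎)) (-‿cong A^m≈1)
        where
        open ≡-Reasoning
        h = m / 2
        m≡1+h*2 : m ≡ 1 ℕ.+ h ℕ.* 2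
        m≡1+h*2 = trans (m≡m%n+[m/n]*n m 2) (cong (ℕ._+ h ℕ.* 2) m-odd)

      [-A]^[i+m]≈-[-A]^i : ∀ i → (- A) ^ (i ℕ.+ m) ≈ - ((- A) ^ i)
      [-A]^[i+m]≈-[-A]^i i = begin
        (- A) ^ (i ℕ.+ m)        ≡⟨ ^-distribˡ-+-* (- A) i m ⟩
        (- A) ^ i * (- A) ^ m    ≈⟨ *-congˡ ((- A) ^ i) [-A]^m≈-1 ⟩
        (- A) ^ i * - 1ℤ         ≡⟨ *-neg-1 ((- A) ^ i) ⟩
        - ((- A) ^ i)            ∎
        where
        open ≈-Reasoning ≈-setoid
        *-neg-1 : ∀ x → x * - 1ℤ ≡ - x
        *-neg-1 = solve-∀

      ±A^i-reachable : ∀ i → (∃[ k ] (- A) ^ k ≈ A ^ i) × (∃[ k ] (- A) ^ k ≈ - (A ^ i))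
      ±A^i-reachable i with -‿^-sign A i
      ... | inj₁ e = (i , ≈-reflexive e)
                   , (i ℕ.+ m , ≈-trans ([-A]^[i+m]≈-[-A]^i i) (≈-reflexive (cong -_ e)))
      ... | inj₂ e = (i ℕ.+ m , ≈-trans ([-A]^[i+m]≈-[-A]^i i)
                                        (≈-reflexive (trans (cong -_ e) (neg-involutive _))))
                   , (i , ≈-reflexive e)

      powers-of-negation : ∀ {z} → (∃[ k ] z ≈ (- A) ^ k) ⇔ (∃[ i ] (z ≈ A ^ toℕ {m} i ⊎ z ≈ - (A ^ toℕ i)))
      powers-of-negation {z} = mk⇔ to from
        where
        to : ∃[ k ] z ≈ (- A) ^ k → ∃[ i ] (z ≈ A ^ toℕ {m} i ⊎ z ≈ - (A ^ toℕ i))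
        to (k , z≈[-A]^k) with ^-reduce k | -‿^-sign A k
        ... | r , r<m , A^k≈A^r | inj₁ e =
          fromℕ< r<m , inj₁ (≈-trans z≈[-A]^k (≈-trans (≈-reflexive e) (≈-trans A^k≈A^r A^r≡A^i)))
          where A^r≡A^i = ≈-reflexive (cong (A ^_) (sym (toℕ-fromℕ< r<m)))
        ... | r , r<m , A^k≈A^r | inj₂ e =
          fromℕ< r<m , inj₂ (≈-trans z≈[-A]^k (≈-trans (≈-reflexive e) (-‿cong (≈-trans A^k≈A^r A^r≡A^i))))
          where A^r≡A^i = ≈-reflexive (cong (A ^_) (sym (toℕ-fromℕ< r<m)))
        from : ∃[ i ] (z ≈ A ^ toℕ {m} i ⊎ z ≈ - (A ^ toℕ i)) → ∃[ k ] z ≈ (- A) ^ k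
        from (i , inj₁ z≈A^i) with ±A^i-reachable (toℕ i)
        ... | (k , [-A]^k≈A^i) , _ = k , ≈-trans z≈A^i (≈-sym [-A]^k≈A^i)
        from (i , inj₂ z≈-A^i) with ±A^i-reachable (toℕ i)
        ... | _ , (k , [-A]^k≈-A^i) = k , ≈-trans z≈-A^i (≈-sym [-A]^k≈-A^i)

  module Cosets (m n a : ℕ) where
    open Congruence n

    A : ℤ
    A = + a

    InA⇔≈ : ∀ (w : Zζ m) {x y} → evalAt A w ≡ x - y → InA m n a w ⇔ x ≈ y
    InA⇔≈ w w≡x-y = -≈0⇔≈ ⇔-∘ mk⇔ (subst (_≈ 0ℤ) w≡x-y ∘ fromMod) (toMod ∘ subst (_≈ 0ℤ) (sym w≡x-y))

    toCoset : Fin n → Zζ m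
    toCoset x = embed (+ toℕ x)

    module _ (1≤φ : 1 ≤ φ m) where

      evalAt-⊖-toCoset : ∀ v x → evalAt A (v ⊖ toCoset x) ≡ evalAt A v - + toℕ x
      evalAt-⊖-toCoset v x =
        trans (evalAt-⊖ A v (toCoset x)) (cong (λ e → evalAt A v - e) (evalAt-embed A _ 1≤φ))

      evalAt-toCoset⊖toCoset : ∀ x y → evalAt A (toCoset x ⊖ toCoset y) ≡ + toℕ x - + toℕ y
      evalAt-toCoset⊖toCoset x y =
        trans (evalAt-⊖-toCoset (toCoset x) y) (cong (_- + toℕ y) (evalAt-embed A _ 1≤φ))

      toCoset-injective : ∀ x y → InA m n a (toCoset x ⊖ toCoset y) → x ≡ y
      toCoset-injective x y x-y∈A = toℕ-injective (≈⇒≡ (toℕ<n x) (toℕ<n y)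
        (Equivalence.to (InA⇔≈ (toCoset x ⊖ toCoset y) (evalAt-toCoset⊖toCoset x y)) x-y∈A))

      toCoset-surjective : .{{_ : NonZero n}} → ∀ v → ∃[ x ] InA m n a (v ⊖ toCoset x)
      toCoset-surjective v = x , Equivalence.from (InA⇔≈ (v ⊖ toCoset x) (evalAt-⊖-toCoset v x)) (begin
        evalAt A v           ≈⟨ ≈-%ℕ (evalAt A v) ⟩
        + (evalAt A v %ℕ n)  ≡⟨ cong +_ (toℕ-fromℕ< (n%ℕd<d (evalAt A v) n)) ⟨
        + toℕ x              ∎)
        where
        open ≈-Reasoning ≈-setoid
        x = fromℕ< (n%ℕd<d (evalAt A v) n)

      module _ (evalAt-ζ^≈ : ∀ i → i < m → evalAt A (ζ^ m i) ≈ A ^ i) where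

        GAdj-toCoset⇔ : ∀ x y → let d = + toℕ x - + toℕ y in
          GAdj m n a (toCoset x) (toCoset y) ⇔ (∃[ i ] (d ≈ A ^ toℕ {m} i ⊎ d ≈ - (A ^ toℕ i)))
        GAdj-toCoset⇔ x y =
          mk⇔ (λ (i , p) → i , Equivalence.to (sides i) p) (λ (i , q) → i , Equivalence.from (sides i) q)
          where
          d = + toℕ x - + toℕ y
          w = toCoset x ⊖ toCoset y
          sides : ∀ (i : Fin m) → let ζⁱ = ζ^ m (toℕ i) in
                  (InA m n a (w ⊖ ζⁱ) ⊎ InA m n a (w ⊕ ζⁱ)) ⇔ (d ≈ A ^ toℕ i ⊎ d ≈ - (A ^ toℕ i))
          sides i = (≈-cong⇔ ≈-refl ζⁱ≈Aⁱ ⇔-∘ InA⇔≈ (w ⊖ ζⁱ) evalAt-w⊖ζⁱ)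
                ⊎-⇔ (≈-cong⇔ ≈-refl (-‿cong ζⁱ≈Aⁱ) ⇔-∘ InA⇔≈ (w ⊕ ζⁱ) evalAt-w⊕ζⁱ)
            where
            ζⁱ = ζ^ m (toℕ i)
            ζⁱ≈Aⁱ = evalAt-ζ^≈ (toℕ i) (toℕ<n i)
            evalAt-w⊖ζⁱ : evalAt A (w ⊖ ζⁱ) ≡ d - evalAt A ζⁱ
            evalAt-w⊖ζⁱ = trans (evalAt-⊖ A w ζⁱ) (cong (_- evalAt A ζⁱ) (evalAt-toCoset⊖toCoset x y))
            evalAt-w⊕ζⁱ : evalAt A (w ⊕ ζⁱ) ≡ d - - evalAt A ζⁱ
            evalAt-w⊕ζⁱ = trans (evalAt-⊕ A w ζⁱ)
                                (cong₂ _+_ (evalAt-toCoset⊖toCoset x y) (sym (neg-involutive _)))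

        cayleyIso : .{{_ : NonZero n}} → m % 2 ≡ 1 → A ^ m ≈ 1ℤ → CayIsoG m n a
        cayleyIso m-odd A^m≈1 = record
          { f    = toCoset
          ; inj  = toCoset-injective
          ; surj = toCoset-surjective
          ; adj⇒ = λ x y (k , x-y≡[-a]ᵏ) →
              from (GAdj-toCoset⇔ x y) (to powers-of-negation (k , fromMod x-y≡[-a]ᵏ))
          ; adj⇐ = λ x y adjacent →
              Product.map₂ toMod (from powers-of-negation (to (GAdj-toCoset⇔ x y) adjacent))
          }
          where
          open PowersOfNegation {m} m-odd {A} A^m≈1
          open Equivalence

open DivisorSum using (φ-positive)
open PowerBasis using (evalAt; evalAt-ζ^; sumFin≡sumℕ)
open CayleyGraph using (module Congruence; module Cosets)
open import Data.Nat.Base using (ℕ; suc; _≤_; _<_; _%_)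
open import Data.Nat.Properties using (_<?_; ≮⇒≥; <⇒≤)
open import Data.Integer.Base using (+_; -_; _^_; _*_)
open import Data.Product.Base using (_×_)
open import Relation.Nullary using (¬_; yes; no)

lemma5p1 : (m n a : ℕ) →
    2 ≤ m → m % 2 ≡ 1 → 3 ≤ n → n % 2 ≡ 1 → 1 ≤ a →
    (∀ i → φ m ≤ i → i < m →
      (+ a) ^ i ≡ sumℕ (φ m) (λ j → c m i j * (+ a) ^ j) [mod n ]) →
    (+ a) ^ m ≡ + 1 [mod n ] →
    (∀ i → 1 ≤ i → i < m →
      ¬ ((+ a) ^ i ≡ + 1 [mod n ]) × ¬ ((+ a) ^ i ≡ - (+ 1) [mod n ])) →
    CayIsoG m n a
lemma5p1 m n@(suc _) a 2≤m m-odd _ _ _ high-powers a^m≡1 _ =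
  Cosets.cayleyIso m n a (φ-positive m 1≤m) evalAt-ζ^≈ m-odd (fromMod a^m≡1)
  where
  open Congruence n
  1≤m : 1 ≤ m
  1≤m = <⇒≤ 2≤m
  evalAt-ζ^≈ : ∀ i → i < m → evalAt (+ a) (ζ^ m i) ≈ (+ a) ^ i
  evalAt-ζ^≈ i i<m with i <? φ m
  ... | yes i<φ = ≈-reflexive (evalAt-ζ^ (+ a) 1≤m i<φ)
  ... | no  i≮φ = ≈-trans (≈-reflexive (sumFin≡sumℕ (φ m) (λ j → c m i j * (+ a) ^ j)))
                          (≈-sym (fromMod (high-powers i (≮⇒≥ i≮φ) i<m)))
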